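{- Let $m$ and $M$ be two positive integers. If $\rho (m,M)=0$, then $\mathsf{D}(\llbracket -m,M \rrbracket ) = m+M$.
   Context: A finite sequence of integers is an unordered finite multiset of integers; its length is its number of elements counted with multiplicity. $S=s_1\cdots s_n$ is a zero-sum sequence if $\sum s_i=0$, and minimal if moreover no non-empty proper subsequence sums to $0$. For integers $a\le b$, $\llbracket a,b\rrbracket$ is the set of integers between $a$ and $b$. $\mathsf{D}(\llbracket -m,M\rrbracket)$ is the maximal length of a minimal zero-sum sequence with all elements in $\llbracket -m,M\rrbracket$. Define $\rho(m,M)=\min\{t\in\mathbb{Z}_{\ge 0} : \exists\, t'\in\mathbb{Z},\ 0\le t'\le t,\ \gcd(M-t',\,m-(t-t'))=1\}$. -}

module Defs where

open import Data.Nat as ℕ using (ℕ; zero; suc)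
open import Data.Integer as ℤ using (ℤ; +_; -_; _-_)
open import Data.Integer.GCD using (gcd)
open import Data.List using (List; length; foldr)
open import Data.List.Relation.Unary.All using (All)
open import Data.List.Relation.Binary.Sublist.Propositional using (_⊆_)
open import Data.Product using (Σ; ∃; _×_; _,_)
open import Relation.Binary.PropositionalEquality using (_≡_)
open import Relation.Nullary using (¬_)

-- A finite sequence (multiset) of integers is represented by a list;
-- all notions below are invariant under permutation.

InInterval : ℤ → ℤ → ℤ → Set
InInterval a b x = a ℤ.≤ x × x ℤ.≤ b

sumℤ : List ℤ → ℤ
sumℤ = foldr ℤ._+_ (+ 0)

ZeroSum : List ℤ → Set
ZeroSum S = sumℤ S ≡ + 0

-- Subsequences of a sequence = sub-multisets = sublists of the list.
MinimalZeroSum : List ℤ → Set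
MinimalZeroSum S =
  ZeroSum S ×
  (∀ (T : List ℤ) → T ⊆ S → 0 ℕ.< length T → length T ℕ.< length S → ¬ ZeroSum T)

OverInterval : ℕ → ℕ → List ℤ → Set
OverInterval m M S = All (InInterval (- (+ m)) (+ M)) S

DIs : ℕ → ℕ → ℕ → Set
DIs m M d =
  (Σ (List ℤ) λ S → OverInterval m M S × MinimalZeroSum S × length S ≡ d) ×
  (∀ (S : List ℤ) → OverInterval m M S → MinimalZeroSum S → length S ℕ.≤ d)

RhoCond : ℕ → ℕ → ℕ → Set
RhoCond m M t =
  Σ ℤ λ t' → + 0 ℤ.≤ t' × t' ℤ.≤ + t ×
    gcd (+ M - t') (+ m - (+ t - t')) ≡ + 1

RhoIs : ℕ → ℕ → ℕ → Set
RhoIs m M r = RhoCond m M r × (∀ t → t ℕ.< r → ¬ RhoCond m M t)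

-- Upper bound: the terms of a zero-sum sequence over ⟦-m, M⟧ can be reordered so that every
-- partial sum lies in ⟦-m, M - 1⟧, a set of m + M integers: add a non-negative term while the
-- running sum is negative and a non-positive one otherwise. If the sequence were longer than
-- m + M, two of the partial sums of lengths 0, …, m + M would coincide, and the terms between
-- them would form a proper non-empty zero-sum subsequence.
-- Lower bound: ρ(m, M) = 0 says gcd(m, M) = 1, and then M^m (-m)^M is minimal: a zero-sum
-- subsequence M^a (-m)^b has a M = b m, so m ∣ a, which forces a ∈ {0, m}.
module Submission where

open import Defs
open import Algebra.Bundles using (CommutativeMonoid)
open import Data.Integer as ℤ using (ℤ; +_; -_; _-_)
import Data.Integer.Properties as ℤ
open import Algebra.Properties.AbelianGroup ℤ.+-0-abelianGroup
  using (inverseʳ-unique; identityʳ-unique; ∙-cancelˡ; ∙-cancelʳ)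
open import Data.List using (List; []; _∷_; _++_; length; replicate; take; drop)
import Data.List.Properties as List
open import Data.List.Membership.Propositional using (_∈_; find)
import Data.List.Relation.Unary.All as All
import Data.List.Relation.Unary.All.Properties as All
open import Data.List.Relation.Unary.Any using (Any; here; there)
open import Data.List.Membership.Propositional.Properties using (∈-∃++)
open import Data.List.Relation.Binary.Permutation.Propositional as ↭ using (_↭_; ↭⇒↭ₛ)
open import Data.List.Relation.Binary.Permutation.Propositional.Properties
  using (shift; ↭-length; All-resp-↭)
open import Data.List.Relation.Binary.Permutation.Setoid.Properties using (foldr-commMonoid)
open import Data.List.Relation.Binary.Sublist.Propositional using (_⊆_; []; _∷_; _∷ʳ_; ⊆-trans)
open import Data.List.Relation.Binary.Sublist.Propositional.Properties
  using (take-⊆; drop-⊆; length-mono-≤)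
open import Data.Nat as ℕ using (ℕ; zero; suc; _+_; _<_)
import Data.Nat.Properties as ℕ
open import Data.Nat.Coprimality as Coprime using (Coprime; gcd≡1⇒coprime; coprime-divisor)
open import Data.Nat.Divisibility using (divides; ∣⇒≤)
open import Data.Nat.GCD using (gcd)
open import Data.Fin using (Fin; toℕ; fromℕ<)
import Data.Fin.Properties as Fin
open import Data.Product using (∃; ∃₂; _×_; _,_; proj₁; proj₂)
open import Data.Sum using (_⊎_; inj₁; inj₂)
open import Function using (_∘_; _⇔_; mk⇔; Equivalence)
open import Relation.Binary.Core using (_Preserves_⟶_)
open import Relation.Binary.PropositionalEquality
open import Level using (Level)
open import Relation.Nullary using (¬_; yes; no)

private variable
  ℓ : Level
  A : Set ℓ

sumℤ-++ : ∀ xs ys → sumℤ (xs ++ ys) ≡ sumℤ xs ℤ.+ sumℤ ys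
sumℤ-++ []       ys = sym (ℤ.+-identityˡ (sumℤ ys))
sumℤ-++ (x ∷ xs) ys = trans (cong (ℤ._+_ x) (sumℤ-++ xs ys)) (sym (ℤ.+-assoc x (sumℤ xs) (sumℤ ys)))

sumℤ-↭ : sumℤ Preserves _↭_ ⟶ _≡_
sumℤ-↭ p = foldr-commMonoid +-0.setoid +-0.isCommutativeMonoid (↭⇒↭ₛ p)
  where module +-0 = CommutativeMonoid ℤ.+-0-commutativeMonoid

∈-∃↭ : ∀ {x : A} {xs} → x ∈ xs → ∃ λ ys → xs ↭ x ∷ ys
∈-∃↭ {x = x} x∈xs with ys , zs , refl ← ∈-∃++ x∈xs = ys ++ zs , shift x ys zs

⊆-↭⇒↭-⊆ : ∀ {ts xs ys : List A} → ts ⊆ xs → xs ↭ ys → ∃ λ us → ts ↭ us × us ⊆ ys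
⊆-↭⇒↭-⊆ τ                   ↭.refl         = _ , ↭.refl , τ
⊆-↭⇒↭-⊆ (x ∷ʳ τ)            (↭.prep x p)   with _ , σ , υ ← ⊆-↭⇒↭-⊆ τ p = _ , σ , x ∷ʳ υ
⊆-↭⇒↭-⊆ (refl ∷ τ)          (↭.prep x p)   with _ , σ , υ ← ⊆-↭⇒↭-⊆ τ p = _ , ↭.prep x σ , refl ∷ υ
⊆-↭⇒↭-⊆ (x ∷ʳ (y ∷ʳ τ))     (↭.swap x y p) with _ , σ , υ ← ⊆-↭⇒↭-⊆ τ p = _ , σ , y ∷ʳ (x ∷ʳ υ)
⊆-↭⇒↭-⊆ (x ∷ʳ (refl ∷ τ))   (↭.swap x y p) with _ , σ , υ ← ⊆-↭⇒↭-⊆ τ p = _ , ↭.prep y σ , refl ∷ (x ∷ʳ υ)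
⊆-↭⇒↭-⊆ (refl ∷ (y ∷ʳ τ))   (↭.swap x y p) with _ , σ , υ ← ⊆-↭⇒↭-⊆ τ p = _ , ↭.prep x σ , y ∷ʳ (refl ∷ υ)
⊆-↭⇒↭-⊆ (refl ∷ (refl ∷ τ)) (↭.swap x y p) with _ , σ , υ ← ⊆-↭⇒↭-⊆ τ p = _ , ↭.swap x y σ , refl ∷ (refl ∷ υ)
⊆-↭⇒↭-⊆ τ                   (↭.trans p q)
  with _ , σ , υ ← ⊆-↭⇒↭-⊆ τ p
  with _ , σ′ , υ′ ← ⊆-↭⇒↭-⊆ υ q = _ , ↭.trans σ σ′ , υ′

minimalZeroSum-↭ : ∀ {xs ys} → xs ↭ ys → MinimalZeroSum ys → MinimalZeroSum xs
minimalZeroSum-↭ p (zs , minimal) =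
  trans (sumℤ-↭ p) zs ,
  λ ts τ 0<|ts| |ts|<|xs| zs-ts → let us , σ , υ = ⊆-↭⇒↭-⊆ τ p in
    minimal us υ (subst (0 <_) (↭-length σ) 0<|ts|)
      (subst₂ _<_ (↭-length σ) (↭-length p) |ts|<|xs|) (trans (sym (sumℤ-↭ σ)) zs-ts)

sum≥0⇒any≥0 : ∀ x xs → + 0 ℤ.≤ sumℤ (x ∷ xs) → Any (+ 0 ℤ.≤_) (x ∷ xs)
sum≥0⇒any≥0 x []       0≤Σ = here (subst (+ 0 ℤ.≤_) (ℤ.+-identityʳ x) 0≤Σ)
sum≥0⇒any≥0 x (y ∷ ys) 0≤Σ with + 0 ℤ.≤? x
... | yes 0≤x = here 0≤x
... | no  0≰x = there (sum≥0⇒any≥0 y ys 0≤Σ′)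
  where
  open ℤ.≤-Reasoning
  0≤Σ′ : + 0 ℤ.≤ sumℤ (y ∷ ys)
  0≤Σ′ = begin
    + 0                      ≤⟨ 0≤Σ ⟩
    x ℤ.+ sumℤ (y ∷ ys)      ≤⟨ ℤ.+-monoˡ-≤ (sumℤ (y ∷ ys)) (ℤ.<⇒≤ (ℤ.≰⇒> 0≰x)) ⟩
    + 0 ℤ.+ sumℤ (y ∷ ys)    ≡⟨ ℤ.+-identityˡ _ ⟩
    sumℤ (y ∷ ys)            ∎

sum≤0⇒any≤0 : ∀ x xs → sumℤ (x ∷ xs) ℤ.≤ + 0 → Any (ℤ._≤ + 0) (x ∷ xs)
sum≤0⇒any≤0 x []       Σ≤0 = here (subst (ℤ._≤ + 0) (ℤ.+-identityʳ x) Σ≤0)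
sum≤0⇒any≤0 x (y ∷ ys) Σ≤0 with x ℤ.≤? + 0
... | yes x≤0 = here x≤0
... | no  x≰0 = there (sum≤0⇒any≤0 y ys Σ′≤0)
  where
  open ℤ.≤-Reasoning
  Σ′≤0 : sumℤ (y ∷ ys) ℤ.≤ + 0
  Σ′≤0 = begin
    sumℤ (y ∷ ys)            ≡⟨ ℤ.+-identityˡ _ ⟨
    + 0 ℤ.+ sumℤ (y ∷ ys)    ≤⟨ ℤ.+-monoˡ-≤ (sumℤ (y ∷ ys)) (ℤ.<⇒≤ (ℤ.≰⇒> x≰0)) ⟩
    x ℤ.+ sumℤ (y ∷ ys)      ≤⟨ Σ≤0 ⟩
    + 0                      ∎

length-drop-take : ∀ i j (xs : List A) → j ℕ.≤ length xs → length (drop i (take j xs)) ≡ j ℕ.∸ i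
length-drop-take i j xs j≤|xs| = begin
  length (drop i (take j xs))   ≡⟨ List.length-drop i (take j xs) ⟩
  length (take j xs) ℕ.∸ i      ≡⟨ cong (ℕ._∸ i) (List.length-take j xs) ⟩
  j ℕ.⊓ length xs ℕ.∸ i         ≡⟨ cong (ℕ._∸ i) (ℕ.m≤n⇒m⊓n≡m j≤|xs|) ⟩
  j ℕ.∸ i                       ∎
  where open ≡-Reasoning

drop-take-zeroSum : ∀ {i j} xs → i ℕ.≤ j → sumℤ (take i xs) ≡ sumℤ (take j xs) →
                    ZeroSum (drop i (take j xs))
drop-take-zeroSum {i} {j} xs i≤j Σᵢ≡Σⱼ = identityʳ-unique (sumℤ (take i xs)) _ (begin
  sumℤ (take i xs) ℤ.+ sumℤ segment            ≡⟨ cong (λ ys → sumℤ ys ℤ.+ sumℤ segment) take-i-take-j ⟨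
  sumℤ (take i (take j xs)) ℤ.+ sumℤ segment   ≡⟨ sumℤ-++ (take i (take j xs)) segment ⟨
  sumℤ (take i (take j xs) ++ segment)         ≡⟨ cong sumℤ (List.take++drop≡id i (take j xs)) ⟩
  sumℤ (take j xs)                             ≡⟨ Σᵢ≡Σⱼ ⟨
  sumℤ (take i xs)                             ∎)
  where
  open ≡-Reasoning
  segment = drop i (take j xs)
  take-i-take-j : take i (take j xs) ≡ take i xs
  take-i-take-j = trans (List.take-take i j xs) (cong (λ k → take k xs) (ℕ.m≤n⇒m⊓n≡m i≤j))

pigeonhole-ℕ : ∀ n (f : ℕ → ℕ) → (∀ i → f i < n) → ∃₂ λ i j → i < j × j ℕ.≤ n × f i ≡ f j
pigeonhole-ℕ n f f<n =
  let i , j , i<j , gi≡gj = Fin.pigeonhole (ℕ.n<1+n n) g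
  in toℕ i , toℕ j , i<j , ℕ.≤-pred (Fin.toℕ<n j) ,
     Fin.fromℕ<-injective _ _ (f<n (toℕ i)) (f<n (toℕ j)) gi≡gj
  where
  g : Fin (suc n) → Fin n
  g i = fromℕ< (f<n (toℕ i))

module _ (m M : ℕ) where

  InWindow : ℤ → Set
  InWindow x = - + m ℤ.≤ x × x ℤ.< + M

  window-step : ∀ {s x xs} → OverInterval m M (x ∷ xs) → InWindow s → s ℤ.+ sumℤ (x ∷ xs) ≡ + 0 →
                ∃ λ y → y ∈ x ∷ xs × InWindow (s ℤ.+ y)
  window-step {s} {x} {xs} bounded (-m≤s , s<M) s+Σ≡0
    with s ℤ.<? + 0 | inverseʳ-unique s (sumℤ (x ∷ xs)) s+Σ≡0
  ... | yes s<0 | Σ≡-s =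
    let y , y∈ , 0≤y = find (sum≥0⇒any≥0 x xs (subst (+ 0 ℤ.≤_) (sym Σ≡-s) (ℤ.<⇒≤ (ℤ.neg-mono-< s<0))))
        _ , y≤M = All.lookup bounded y∈
    in y , y∈ , (begin
        - + m        ≤⟨ -m≤s ⟩
        s            ≡⟨ ℤ.+-identityʳ s ⟨
        s ℤ.+ + 0    ≤⟨ ℤ.+-monoʳ-≤ s 0≤y ⟩
        s ℤ.+ y      ∎) , (begin-strict
        s ℤ.+ y      <⟨ ℤ.+-monoˡ-< y s<0 ⟩
        + 0 ℤ.+ y    ≡⟨ ℤ.+-identityˡ y ⟩
        y            ≤⟨ y≤M ⟩
        + M          ∎)
    where open ℤ.≤-Reasoning
  ... | no s≮0 | Σ≡-s =
    let y , y∈ , y≤0 = find (sum≤0⇒any≤0 x xs (subst (ℤ._≤ + 0) (sym Σ≡-s) (ℤ.neg-mono-≤ (ℤ.≮⇒≥ s≮0))))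
        -m≤y , _ = All.lookup bounded y∈
    in y , y∈ , (begin
        - + m        ≤⟨ -m≤y ⟩
        y            ≡⟨ ℤ.+-identityˡ y ⟨
        + 0 ℤ.+ y    ≤⟨ ℤ.+-monoˡ-≤ y (ℤ.≮⇒≥ s≮0) ⟩
        s ℤ.+ y      ∎) , (begin-strict
        s ℤ.+ y      ≤⟨ ℤ.+-monoʳ-≤ s y≤0 ⟩
        s ℤ.+ + 0    ≡⟨ ℤ.+-identityʳ s ⟩
        s            <⟨ s<M ⟩
        + M          ∎)
    where open ℤ.≤-Reasoning

  StaysInWindow : ℤ → List ℤ → Set
  StaysInWindow s ys = ∀ i → InWindow (s ℤ.+ sumℤ (take i ys))

  arrange : ∀ {n s} xs → length xs ≡ n → OverInterval m M xs → InWindow s → s ℤ.+ sumℤ xs ≡ + 0 →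
            ∃ λ ys → ys ↭ xs × StaysInWindow s ys
  arrange {zero} {s} [] _ _ s∈ _ = [] , ↭.refl , λ { zero → s+0∈ ; (suc _) → s+0∈ }
    where s+0∈ = subst InWindow (sym (ℤ.+-identityʳ s)) s∈
  arrange {suc n} {s} (x ∷ xs) |x∷xs|≡1+n bounded s∈ s+Σ≡0 =
    let y , y∈ , s+y∈ = window-step bounded s∈ s+Σ≡0
        rest , p = ∈-∃↭ y∈
        ys , q , stays = arrange rest (shorter p) (All.tail (All-resp-↭ p bounded)) s+y∈ (rebalance p)
    in y ∷ ys , ↭.trans (↭.prep y q) (↭.↭-sym p) ,
       λ { zero → s+0∈ ; (suc i) → subst InWindow (ℤ.+-assoc s y _) (stays i) }
    where
    s+0∈ = subst InWindow (sym (ℤ.+-identityʳ s)) s∈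

    shorter : ∀ {y rest} → x ∷ xs ↭ y ∷ rest → length rest ≡ n
    shorter p = ℕ.suc-injective (trans (sym (↭-length p)) |x∷xs|≡1+n)

    rebalance : ∀ {y rest} → x ∷ xs ↭ y ∷ rest → s ℤ.+ y ℤ.+ sumℤ rest ≡ + 0
    rebalance {y} {rest} p = begin
      s ℤ.+ y ℤ.+ sumℤ rest    ≡⟨ ℤ.+-assoc s y (sumℤ rest) ⟩
      s ℤ.+ sumℤ (y ∷ rest)    ≡⟨ cong (ℤ._+_ s) (sumℤ-↭ p) ⟨
      s ℤ.+ sumℤ (x ∷ xs)      ≡⟨ s+Σ≡0 ⟩
      + 0                      ∎
      where open ≡-Reasoning

  window-pigeonhole : (f : ℕ → ℤ) → (∀ i → InWindow (f i)) → ∃₂ λ i j → i < j × j ℕ.≤ m + M × f i ≡ f j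
  window-pigeonhole f f∈ =
    let i , j , i<j , j≤m+M , offset≡ = pigeonhole-ℕ (m + M) (offset ∘ f) (offset<m+M ∘ f∈)
    in i , j , i<j , j≤m+M , offset-injective (f∈ i) (f∈ j) offset≡
    where
    offset : ℤ → ℕ
    offset x = ℤ.∣ x ℤ.+ + m ∣

    +offset : ∀ {x} → InWindow x → + offset x ≡ x ℤ.+ + m
    +offset {x} (-m≤x , _) =
      ℤ.0≤i⇒+∣i∣≡i (subst (ℤ._≤ x ℤ.+ + m) (ℤ.+-inverseˡ (+ m)) (ℤ.+-monoˡ-≤ (+ m) -m≤x))

    offset<m+M : ∀ {x} → InWindow x → offset x < m + M
    offset<m+M {x} x∈@(_ , x<M) = ℤ.drop‿+<+ (begin-strict
      + offset x       ≡⟨ +offset x∈ ⟩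
      x ℤ.+ + m        <⟨ ℤ.+-monoˡ-< (+ m) x<M ⟩
      + M ℤ.+ + m      ≡⟨ cong +_ (ℕ.+-comm M m) ⟩
      + (m + M)        ∎)
      where open ℤ.≤-Reasoning

    offset-injective : ∀ {x y} → InWindow x → InWindow y → offset x ≡ offset y → x ≡ y
    offset-injective {x} {y} x∈ y∈ offset≡ =
      ∙-cancelʳ (+ m) x y (trans (sym (+offset x∈)) (trans (cong +_ offset≡) (+offset y∈)))

  zeroSum-segment : ∀ {ys} → StaysInWindow (+ 0) ys → m + M < length ys →
                  ∃ λ ts → ts ⊆ ys × 0 < length ts × length ts < length ys × ZeroSum ts
  zeroSum-segment {ys} stays m+M<|ys| =
    let i , j , i<j , j≤m+M , Σᵢ≡Σⱼ = window-pigeonhole _ stays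
        |ts|≡j∸i = length-drop-take i j ys (ℕ.<⇒≤ (ℕ.≤-<-trans j≤m+M m+M<|ys|))
    in drop i (take j ys) ,
       ⊆-trans (drop-⊆ i (take j ys)) (take-⊆ j ys) ,
       subst (0 <_) (sym |ts|≡j∸i) (ℕ.m<n⇒0<n∸m i<j) ,
       subst (_< length ys) (sym |ts|≡j∸i) (ℕ.≤-<-trans (ℕ.m∸n≤m j i) (ℕ.≤-<-trans j≤m+M m+M<|ys|)) ,
       drop-take-zeroSum ys (ℕ.<⇒≤ i<j) (∙-cancelˡ (+ 0) _ _ Σᵢ≡Σⱼ)

  length≤m+M : 0 < M → ∀ {xs} → OverInterval m M xs → MinimalZeroSum xs → length xs ℕ.≤ m + M
  length≤m+M 0<M {xs} bounded minimal = ℕ.≮⇒≥ λ m+M<|xs| →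
    let ys , ys↭xs , stays =
          arrange xs refl bounded (ℤ.neg-≤-pos , ℤ.+<+ 0<M) (trans (ℤ.+-identityˡ _) (proj₁ minimal))
        ts , τ , 0<|ts| , |ts|<|ys| , zs =
          zeroSum-segment stays (subst (m + M <_) (sym (↭-length ys↭xs)) m+M<|xs|)
    in proj₂ (minimalZeroSum-↭ ys↭xs minimal) ts τ 0<|ts| |ts|<|ys| zs

⊆-++⁻ : ∀ (xs : List A) {ys ts} → ts ⊆ xs ++ ys →
        ∃₂ λ us vs → us ⊆ xs × vs ⊆ ys × ts ≡ us ++ vs
⊆-++⁻ []       τ          = [] , _ , [] , τ , refl
⊆-++⁻ (x ∷ xs) (.x ∷ʳ τ)  with us , vs , υ , ν , refl ← ⊆-++⁻ xs τ = us , vs , x ∷ʳ υ , ν , refl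
⊆-++⁻ (x ∷ xs) (refl ∷ τ) with us , vs , υ , ν , refl ← ⊆-++⁻ xs τ = x ∷ us , vs , refl ∷ υ , ν , refl

⊆-replicate⁻ : ∀ n {x : A} {ts} → ts ⊆ replicate n x → ts ≡ replicate (length ts) x
⊆-replicate⁻ zero    []         = refl
⊆-replicate⁻ (suc n) (_ ∷ʳ τ)   = ⊆-replicate⁻ n τ
⊆-replicate⁻ (suc n) (refl ∷ τ) = cong (_ ∷_) (⊆-replicate⁻ n τ)

blocks : ℕ → ℤ → ℕ → ℤ → List ℤ
blocks a x b y = replicate a x ++ replicate b y

length-blocks : ∀ a x b y → length (blocks a x b y) ≡ a + b
length-blocks a x b y =
  trans (List.length-++ (replicate a x)) (cong₂ _+_ (List.length-replicate a) (List.length-replicate b))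

⊆-blocks⁻ : ∀ a x b y {ts} → ts ⊆ blocks a x b y →
            ∃₂ λ a′ b′ → a′ ℕ.≤ a × b′ ℕ.≤ b × ts ≡ blocks a′ x b′ y
⊆-blocks⁻ a x b y τ with us , vs , υ , ν , refl ← ⊆-++⁻ (replicate a x) τ =
  length us , length vs ,
  subst (length us ℕ.≤_) (List.length-replicate a) (length-mono-≤ υ) ,
  subst (length vs ℕ.≤_) (List.length-replicate b) (length-mono-≤ ν) ,
  cong₂ _++_ (⊆-replicate⁻ a υ) (⊆-replicate⁻ b ν)

sumℤ-replicate : ∀ n x → sumℤ (replicate n x) ≡ + n ℤ.* x
sumℤ-replicate zero    x = sym (ℤ.*-zeroˡ x)
sumℤ-replicate (suc n) x = trans (cong (ℤ._+_ x) (sumℤ-replicate n x)) (sym (ℤ.suc-* (+ n) x))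

sumℤ-blocks : ∀ a M b m → sumℤ (blocks a (+ M) b (- + m)) ≡ + (a ℕ.* M) - + (b ℕ.* m)
sumℤ-blocks a M b m = begin
  sumℤ (blocks a (+ M) b (- + m))
    ≡⟨ sumℤ-++ (replicate a (+ M)) _ ⟩
  sumℤ (replicate a (+ M)) ℤ.+ sumℤ (replicate b (- + m))
    ≡⟨ cong₂ ℤ._+_ (sumℤ-replicate a (+ M)) (sumℤ-replicate b (- + m)) ⟩
  + a ℤ.* + M ℤ.+ + b ℤ.* - + m
    ≡⟨ cong (ℤ._+_ (+ a ℤ.* + M)) (ℤ.neg-distribʳ-* (+ b) (+ m)) ⟨
  + a ℤ.* + M - + b ℤ.* + m
    ≡⟨ cong₂ _-_ (ℤ.pos-* a M) (ℤ.pos-* b m) ⟨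
  + (a ℕ.* M) - + (b ℕ.* m)
    ∎
  where open ≡-Reasoning

zeroSum-blocks : ∀ a M b m → ZeroSum (blocks a (+ M) b (- + m)) ⇔ a ℕ.* M ≡ b ℕ.* m
zeroSum-blocks a M b m = mk⇔
  (λ zs → ℤ.+-injective (ℤ.i-j≡0⇒i≡j _ _ (trans (sym (sumℤ-blocks a M b m)) zs)))
  (λ aM≡bm → trans (sumℤ-blocks a M b m) (ℤ.i≡j⇒i-j≡0 (cong +_ aM≡bm)))

coprime-balance : ∀ {m M} a b → Coprime m M → 0 < m → a ℕ.≤ m → a ℕ.* M ≡ b ℕ.* m →
                  (a ≡ 0 × b ≡ 0) ⊎ (a ≡ m × b ≡ M)
coprime-balance {m} zero b _ 0<m _ aM≡bm = inj₁ (refl , ℕ.m*n≡0⇒m≡0 b m {{ℕ.>-nonZero 0<m}} (sym aM≡bm))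
coprime-balance {m} {M} a@(suc _) b m⊥M 0<m a≤m aM≡bm = inj₂ (a≡m , b≡M)
  where
  a≡m : a ≡ m
  a≡m = ℕ.≤-antisym a≤m (∣⇒≤ (coprime-divisor m⊥M (divides b (trans (ℕ.*-comm M a) aM≡bm))))
  b≡M : b ≡ M
  b≡M = ℕ.*-cancelʳ-≡ b M m {{ℕ.>-nonZero 0<m}}
          (trans (sym aM≡bm) (trans (cong (ℕ._* M) a≡m) (ℕ.*-comm m M)))

coprime⇒minimalZeroSum : ∀ {m M} → Coprime m M → 0 < m → MinimalZeroSum (blocks m (+ M) M (- + m))
coprime⇒minimalZeroSum {m} {M} m⊥M 0<m = Equivalence.from (zeroSum-blocks m M M m) (ℕ.*-comm m M) , proper
  where
  S = blocks m (+ M) M (- + m)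
  proper : ∀ ts → ts ⊆ S → 0 < length ts → length ts < length S → ¬ ZeroSum ts
  proper ts τ 0<|ts| |ts|<|S| zs with a , b , a≤m , _ , refl ← ⊆-blocks⁻ m (+ M) M (- + m) τ
    with coprime-balance a b m⊥M 0<m a≤m (Equivalence.to (zeroSum-blocks a M b m) zs)
  ... | inj₁ (refl , refl) = ℕ.<-irrefl refl 0<|ts|
  ... | inj₂ (refl , refl) = ℕ.<-irrefl refl |ts|<|S|

ρ≡0⇒coprime : ∀ {m M} → RhoIs m M 0 → Coprime m M
ρ≡0⇒coprime {m} {M} ((+ zero , _ , _ , gcd≡1) , _) = Coprime.sym (gcd≡1⇒coprime
  (subst₂ (λ a b → gcd a b ≡ 1) (ℕ.+-identityʳ M) (ℕ.+-identityʳ m) (ℤ.+-injective gcd≡1)))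
ρ≡0⇒coprime ((+ suc _ , _ , ℤ.+≤+ () , _) , _)
ρ≡0⇒coprime ((ℤ.-[1+ _ ] , () , _) , _)

proposition3p3 : (m M : ℕ) → 0 < m → 0 < M → RhoIs m M 0 → DIs m M (m + M)
proposition3p3 m M 0<m 0<M ρ≡0 =
  (blocks m (+ M) M (- + m) ,
   All.++⁺ (All.replicate⁺ m (ℤ.neg-≤-pos , ℤ.≤-refl)) (All.replicate⁺ M (ℤ.≤-refl , ℤ.neg-≤-pos)) ,
   coprime⇒minimalZeroSum (ρ≡0⇒coprime ρ≡0) 0<m ,
   length-blocks m (+ M) M (- + m)) ,
  λ S bounded minimal → length≤m+M m M 0<M bounded minimal
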